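{- Let $\mathcal{H}$ be a finite hypergraph and let $r,s,C$ be positive integers. Let $\widetilde{\mathcal{T}}_{\mathcal{H},C,s}$ be the hypergraph with vertex set $V(\mathcal{H})$ and edge set $\{A\subseteq V(\mathcal{H}): |A|-\operatorname{alt}_s(\mathcal{H}[A])>(s-1)C\}$. Then $$\operatorname{alt}_r(\widetilde{\mathcal{T}}_{\mathcal{H},C,s})\leq r(s-1)C+\operatorname{alt}_{rs}(\mathcal{H}).$$
   Context: A hypergraph $\mathcal{H}=(V,E)$ consists of a finite vertex set $V$ and a set $E$ of subsets of $V$. For $X\subseteq V$, $\mathcal{H}[X]$ has vertex set $X$ and edge set $\{e\in E: e\subseteq X\}$. Alternation number: for a positive integer $q$, $Z_q$ is the multiplicative group of $q$-th roots of unity with generator $\omega$. For $\boldsymbol{x}\in(Z_q\cup\{0\})^n$, $\operatorname{supp}_j(\boldsymbol{x})=\{i: x_i=\omega^j\}$. For a permutation $\pi$ of $[n]$, $\operatorname{alt}_\pi(\boldsymbol{x})$ is the maximum length of a subsequence of $x_{\pi(1)},\ldots,x_{\pi(n)}$ consisting of nonzero entries in which any two consecutive terms differ (it is $0$ for the zero vector). For a hypergraph $\mathcal{G}$ whose vertex set (of size $n$) is identified with $[n]$ (the value does not depend on the identification), $\operatorname{alt}_q(\mathcal{G})=\min_{\pi\in\mathcal{S}_n}\max\{\operatorname{alt}_\pi(\boldsymbol{x}): \boldsymbol{x}\in(Z_q\cup\{0\})^n,\ E(\mathcal{G}[\operatorname{supp}_j(\boldsymbol{x})])=\emptyset \text{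 for } j=1,\ldots,q\}$. -}

module Defs where

open import Data.Bool using (Bool; true; false; _∧_; _∨_; not; if_then_else_)
open import Data.Nat using (ℕ; zero; suc; _+_; _*_; _∸_; _⊔_; _⊓_; _<ᵇ_; _≡ᵇ_)
open import Data.Fin using (Fin; zero; suc; _≟_)
open import Data.Fin.Subset using (Subset; inside; outside; _∈_; ⁅_⁆; ∣_∣)
open import Data.Fin.Subset.Properties using (_⊆?_; _∈?_)
open import Data.List using (List; []; _∷_; map; concatMap; filter; length; _++_; allFin)
open import Data.Bool.ListAction using (all; any)
open import Data.Maybe using (Maybe; just; nothing)
open import Data.Vec using (Vec; lookup; tabulate)
open import Relation.Nullary.Decidable using (⌊_⌋)

Hypergraph : ℕ → Set
Hypergraph n = Subset n → Bool

allSubsets : (n : ℕ) → List (Subset n)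
allSubsets zero    = Data.Vec.[] ∷ []
allSubsets (suc n) = concatMap (λ s → (outside Data.Vec.∷ s) ∷ (inside Data.Vec.∷ s) ∷ []) (allSubsets n)

elems : {n : ℕ} → Subset n → List (Fin n)
elems X = filter (λ i → i ∈? X) (allFin _)

maxList : List ℕ → ℕ
maxList []       = 0
maxList (x ∷ xs) = x ⊔ maxList xs

-- minimum of a list of naturals (0 for the empty list; only used on
-- nonempty lists below)
minList : List ℕ → ℕ
minList []       = 0
minList (x ∷ []) = x
minList (x ∷ y ∷ ys) = x ⊓ minList (y ∷ ys)

sublists : {A : Set} → List A → List (List A)
sublists []       = [] ∷ []
sublists (x ∷ xs) = let r = sublists xs in r ++ map (x ∷_) r

insertions : {A : Set} → A → List A → List (List A)
insertions x []       = (x ∷ []) ∷ []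
insertions x (y ∷ ys) = (x ∷ y ∷ ys) ∷ map (y ∷_) (insertions x ys)

permutations : {A : Set} → List A → List (List A)
permutations []       = [] ∷ []
permutations (x ∷ xs) = concatMap (insertions x) (permutations xs)

-- Alternation number.
-- An element of Z_q ∪ {0} is  Maybe (Fin q):  nothing = 0,  just j = ω^j.

Entry : ℕ → Set
Entry q = Maybe (Fin q)

sameB : {q : ℕ} → Fin q → Fin q → Bool
sameB i j = ⌊ i ≟ j ⌋

alternating : {q : ℕ} → List (Entry q) → Bool
alternating []                        = true
alternating (nothing ∷ _)             = false
alternating (just a ∷ [])             = true
alternating (just a ∷ nothing ∷ _)    = false
alternating (just a ∷ just b ∷ ys)    = not (sameB a b) ∧ alternating (just b ∷ ys)

altπ : {n q : ℕ} → List (Fin n) → (Fin n → Entry q) → ℕ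
altπ π x = maxList (map length (filter (λ l → alternating l Data.Bool.≟ true) (sublists (map x π))))

allVecs : (q n : ℕ) → List (Vec (Entry q) n)
allVecs q zero    = Data.Vec.[] ∷ []
allVecs q (suc n) =
  concatMap (λ v → map (λ e → e Data.Vec.∷ v) (nothing ∷ map just (allFin q))) (allVecs q n)

supp : {n q : ℕ} → (Fin n → Entry q) → Fin q → Subset n
supp x j = tabulate (λ i → isJ (x i))
  where
  isJ : Maybe _ → Bool
  isJ nothing  = false
  isJ (just k) = sameB k j

-- x is supported in X (so it is a vector indexed by the vertex set X)
supportedIn : {n q : ℕ} → Subset n → (Fin n → Entry q) → Bool
supportedIn X x = all (λ i → ⌊ i ∈? X ⌋ ∨ isZero (x i)) (allFin _)
  where
  isZero : Maybe _ → Bool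
  isZero nothing  = true
  isZero (just _) = false

-- G[S] has no edge, where G is the hypergraph with vertex set X and edges
-- {e ∈ E : e ⊆ X} and S ⊆ X: no edge e of E satisfies e ⊆ S
edgeFree : {n : ℕ} → Hypergraph n → Subset n → Bool
edgeFree E S = not (any (λ e → E e ∧ ⌊ e ⊆? S ⌋) (allSubsets _))

admissible : {n q : ℕ} → Hypergraph n → (Fin n → Entry q) → Bool
admissible {q = q} E x = all (λ j → edgeFree E (supp x j)) (allFin q)

altInduced : {n : ℕ} → (q : ℕ) → Hypergraph n → Subset n → ℕ
altInduced {n} q E X =
  minList (map (λ π → maxList (map (λ v → altπ π (lookup v))
                                   (filter (λ v → (supportedIn X (lookup v) ∧ admissible E (lookup v)) Data.Bool.≟ true)
                                           (allVecs q n))))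
               (permutations (elems X)))

full : (n : ℕ) → Subset n
full n = tabulate (λ _ → true)

alt : {n : ℕ} → (q : ℕ) → Hypergraph n → ℕ
alt q E = altInduced q E (full _)

T̃ : {n : ℕ} → Hypergraph n → (C s : ℕ) → Hypergraph n
T̃ H C s A = ((s ∸ 1) * C + altInduced s H A) <ᵇ ∣ A ∣

-- Take an ordering π of the vertices that is optimal for alt_{rs}(H). Along any ordering, alt_π(x)
-- is the number of maximal blocks of equal nonzero entries of x, hence at most the number of nonzero
-- entries, which is the sum of the sizes of the colour classes S_j of x. If x is admissible for T̃,
-- no S_j is an edge of T̃, so |S_j| ≤ (s-1)C + alt_s(H[S_j]), and alt_s(H[S_j]) is at most the
-- alternation along π restricted to S_j, attained by an admissible s-colouring y_j of H[S_j]. The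
-- rs-colouring v ↦ (x_v, y_{x_v}(v)) of H is admissible, and every block of y_j along S_j opens a
-- block of it along π, so the y_j together contribute at most alt_π of it, i.e. at most alt_{rs}(H).
module Submission where

open import Defs
open import Data.Bool using (Bool; true; false; _∧_; _∨_; T; if_then_else_)
import Data.Bool as Bool
open import Data.Bool.ListAction using (all; any)
open import Data.Bool.Properties using (T-≡)
open import Data.Empty using (⊥-elim)
open import Data.Fin using (Fin; zero; suc; combine)
import Data.Fin as Fin
open import Data.Fin.Properties using (combine-injective; combine-surjective)
open import Data.Fin.Subset using (Subset; _∈_; _⊆_; ∣_∣) renaming (⊥ to ∅)
open import Data.Fin.Subset.Properties using (_∈?_; _⊆?_) renaming (⊥⊆ to ∅⊆)
open import Data.List using (List; []; _∷_; map; filter; length; _++_; allFin; catMaybes)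
open import Data.List.Properties using (filter-all; filter-none; filter-accept; filter-reject; map-cong)
open import Data.List.Membership.Propositional using (lose; find) renaming (_∈_ to _∈ₗ_)
open import Data.List.Membership.Propositional.Properties
import Data.List.Relation.Unary.All as All
open import Data.List.Relation.Unary.All.Properties using (all⁺; all⁻)
import Data.List.Relation.Unary.Any as Any
open import Data.List.Relation.Unary.Any using (here; there)
open import Data.List.Relation.Unary.Any.Properties using (any⁺; any⁻)
open import Data.List.Relation.Binary.Permutation.Propositional
  using (_↭_; ↭-refl; ↭-sym; ↭-trans; prep; swap)
open import Data.List.Relation.Binary.Permutation.Propositional.Properties
  using (↭-empty-inv; ∈-resp-↭; drop-mid; filter-↭; ↭-length)
open import Data.Maybe using (Maybe; just; nothing; _>>=_)
import Data.Maybe as Maybe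
open import Data.Maybe.Properties using (just-injective)
open import Data.Nat using (ℕ; zero; suc; _+_; _*_; _∸_; _≤_; _<ᵇ_; z≤n; s≤s; NonZero)
open import Data.Nat.Properties
open import Algebra.Properties.CommutativeMonoid.Sum +-0-commutativeMonoid
  using (sum; sum-syntax; ∑-distrib-+; sum-cong-≗; sum-replicate-zero)
open import Algebra.Properties.CommutativeSemigroup +-commutativeSemigroup using (x∙yz≈y∙xz)
open import Data.Product using (∃-syntax; _×_; _,_; proj₁; proj₂)
open import Data.Sum using (inj₁; inj₂; [_,_]′)
open import Data.Vec using (Vec; []; _∷_; lookup; tabulate; replicate)
open import Data.Vec.Properties using (lookup∘tabulate; lookup-replicate; []=⇒lookup; lookup⇒[]=)
open import Data.Vec.Functional using (updateAt)
open import Data.Vec.Functional.Properties using (updateAt-updates; updateAt-minimal)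
open import Function using (id; _∘_; Equivalence)
open import Relation.Nullary using (¬_; Dec; yes; no; does)
open import Relation.Nullary.Decidable using (⌊_⌋; toWitness; fromWitness)
open import Relation.Binary.PropositionalEquality

private variable
  A : Set
  n q : ℕ

true≢false : true ≢ false
true≢false ()

nothing≢just : {a : A} → nothing ≢ just a
nothing≢just ()

≤-maxList : {a : ℕ} {xs : List ℕ} → a ∈ₗ xs → a ≤ maxList xs
≤-maxList {xs = x ∷ xs} (here refl)  = m≤m⊔n x (maxList xs)
≤-maxList {xs = x ∷ xs} (there a∈xs) = ≤-trans (≤-maxList a∈xs) (m≤n⊔m x (maxList xs))

maxList-≤ : {b : ℕ} (xs : List ℕ) → (∀ {a} → a ∈ₗ xs → a ≤ b) → maxList xs ≤ b
maxList-≤ []       _     = z≤n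
maxList-≤ (x ∷ xs) xs≤b = ⊔-lub (xs≤b (here refl)) (maxList-≤ xs (xs≤b ∘ there))

maxList-∈ : {a : ℕ} {xs : List ℕ} → a ∈ₗ xs → maxList xs ∈ₗ xs
maxList-∈ {xs = x ∷ []}     _ = here (⊔-identityʳ x)
maxList-∈ {xs = x ∷ y ∷ ys} _ =
  [ here , (λ x⊔m≡m → there (subst (_∈ₗ y ∷ ys) (sym x⊔m≡m) (maxList-∈ (here refl)))) ]′
  (⊔-sel x (maxList (y ∷ ys)))

maxList-map-attained : (f : A → ℕ) (d : A) (xs : List A) → ∃[ a ] a ∈ₗ d ∷ xs × maxList (map f xs) ≤ f a
maxList-map-attained f d xs with ∈-map⁻ f (maxList-∈ {xs = map f (d ∷ xs)} (here refl))
... | a , a∈ , max≡ = a , a∈ , ≤-trans (m≤n⊔m (f d) (maxList (map f xs))) (≤-reflexive max≡)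

minList-≤ : {a : ℕ} {xs : List ℕ} → a ∈ₗ xs → minList xs ≤ a
minList-≤ {xs = x ∷ []}     (here refl)  = ≤-refl
minList-≤ {xs = x ∷ y ∷ xs} (here refl)  = m⊓n≤m x _
minList-≤ {xs = x ∷ y ∷ xs} (there a∈xs) = ≤-trans (m⊓n≤n x _) (minList-≤ a∈xs)

minList-∈ : {a : ℕ} {xs : List ℕ} → a ∈ₗ xs → minList xs ∈ₗ xs
minList-∈ {xs = x ∷ []}     _ = here refl
minList-∈ {xs = x ∷ y ∷ ys} _ =
  [ here , (λ x⊓m≡m → there (subst (_∈ₗ y ∷ ys) (sym x⊓m≡m) (minList-∈ (here refl)))) ]′
  (⊓-sel x (minList (y ∷ ys)))

⌊⌋≡true⁻ : {P : Set} (p? : Dec P) → ⌊ p? ⌋ ≡ true → P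
⌊⌋≡true⁻ p? = toWitness {a? = p?} ∘ Equivalence.from T-≡

⌊⌋≡true⁺ : {P : Set} (p? : Dec P) → P → ⌊ p? ⌋ ≡ true
⌊⌋≡true⁺ p? = Equivalence.to T-≡ ∘ fromWitness {a? = p?}

∧-≡-true⁻ : {a b : Bool} → a ∧ b ≡ true → a ≡ true × b ≡ true
∧-≡-true⁻ {true} {true} _ = refl , refl

∧-≡-true⁺ : {a b : Bool} → a ≡ true → b ≡ true → a ∧ b ≡ true
∧-≡-true⁺ refl refl = refl

∨-≡-true⁺ˡ : {a b : Bool} → a ≡ true → a ∨ b ≡ true
∨-≡-true⁺ˡ refl = refl

all-≡-true⁺ : (p : A → Bool) (xs : List A) → (∀ {x} → x ∈ₗ xs → p x ≡ true) → all p xs ≡ true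
all-≡-true⁺ p xs h = Equivalence.to T-≡ (all⁻ p (All.tabulate (Equivalence.from T-≡ ∘ h)))

all-≡-true⁻ : (p : A → Bool) (xs : List A) → all p xs ≡ true → ∀ {x} → x ∈ₗ xs → p x ≡ true
all-≡-true⁻ p xs h x∈xs = Equivalence.to T-≡ (All.lookup (all⁺ p xs (Equivalence.from T-≡ h)) x∈xs)

any-≡-true⁺ : (p : A → Bool) {xs : List A} {x : A} → x ∈ₗ xs → p x ≡ true → any p xs ≡ true
any-≡-true⁺ p x∈xs px = Equivalence.to T-≡ (any⁺ p (Any.map (λ { refl → Equivalence.from T-≡ px }) x∈xs))

any-≡-true⁻ : (p : A → Bool) (xs : List A) → any p xs ≡ true → ∃[ x ] x ∈ₗ xs × p x ≡ true
any-≡-true⁻ p xs h with find (any⁻ p xs (Equivalence.from T-≡ h))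
... | x , x∈xs , px = x , x∈xs , Equivalence.to T-≡ px

∈-allSubsets : (S : Subset n) → S ∈ₗ allSubsets n
∈-allSubsets []      = here refl
∈-allSubsets (b ∷ S) =
  ∈-concatMap⁺ (λ S → (false ∷ S) ∷ (true ∷ S) ∷ []) (lose (∈-allSubsets S) (∈-extensions b))
  where
  ∈-extensions : (b : Bool) → b ∷ S ∈ₗ (false ∷ S) ∷ (true ∷ S) ∷ []
  ∈-extensions false = here refl
  ∈-extensions true  = there (here refl)

∈-allVecs : (v : Vec (Entry q) n) → v ∈ₗ allVecs q n
∈-allVecs []            = here refl
∈-allVecs {q} (e ∷ v) =
  ∈-concatMap⁺ (λ w → map (_∷ w) (nothing ∷ map just (allFin q)))
               (lose (∈-allVecs v) (∈-map⁺ (_∷ v) (∈-entries e)))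
  where
  ∈-entries : (e : Entry q) → e ∈ₗ nothing ∷ map just (allFin q)
  ∈-entries nothing  = here refl
  ∈-entries (just k) = there (∈-map⁺ just (∈-allFin k))

insertions-↭ : (x : A) (xs ys : List A) → ys ∈ₗ insertions x xs → ys ↭ x ∷ xs
insertions-↭ x []       _ (here refl) = ↭-refl
insertions-↭ x (y ∷ xs) _ (here refl) = ↭-refl
insertions-↭ x (y ∷ xs) _ (there ys∈) with ∈-map⁻ (y ∷_) ys∈
... | zs , zs∈ , refl = ↭-trans (prep y (insertions-↭ x xs zs zs∈)) (swap y x ↭-refl)

∈-insertions : (x : A) (as bs : List A) → as ++ x ∷ bs ∈ₗ insertions x (as ++ bs)
∈-insertions x []       []       = here refl
∈-insertions x []       (b ∷ bs) = here refl
∈-insertions x (a ∷ as) bs       = there (∈-map⁺ (a ∷_) (∈-insertions x as bs))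

∈-permutations⁻ : (xs ys : List A) → ys ∈ₗ permutations xs → ys ↭ xs
∈-permutations⁻ []       _  (here refl) = ↭-refl
∈-permutations⁻ (x ∷ xs) ys ys∈ with find (∈-concatMap⁻ (insertions x) {xs = permutations xs} ys∈)
... | zs , zs∈ , ys∈′ = ↭-trans (insertions-↭ x zs ys ys∈′) (prep x (∈-permutations⁻ xs zs zs∈))

∈-permutations⁺ : (xs ys : List A) → ys ↭ xs → ys ∈ₗ permutations xs
∈-permutations⁺ []       ys ys↭[] rewrite ↭-empty-inv ys↭[] = here refl
∈-permutations⁺ (x ∷ xs) ys ys↭ with ∈-∃++ (∈-resp-↭ (↭-sym ys↭) (here refl))
... | as , bs , refl =
  ∈-concatMap⁺ (insertions x) (lose (∈-permutations⁺ xs (as ++ bs) (drop-mid as [] ys↭)) (∈-insertions x as bs))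

continues : Maybe (Fin q) → Fin q → Bool
continues nothing  a = false
continues (just b) a = sameB b a

continues≡true⁻ : (c : Maybe (Fin q)) {a : Fin q} → continues c a ≡ true → c ≡ just a
continues≡true⁻ (just b) {a} b≟a = cong just (⌊⌋≡true⁻ (b Fin.≟ a) b≟a)

isNew : Maybe (Fin q) → Fin q → ℕ
isNew c a = if continues c a then 0 else 1

-- runsAfter c l counts the maximal blocks of equal entries of l, zeros skipped, when a block of
-- colour c is already open.
runsAfter : Maybe (Fin q) → List (Entry q) → ℕ
runsAfter c []            = 0
runsAfter c (nothing ∷ l) = runsAfter c l
runsAfter c (just a ∷ l)  = isNew c a + runsAfter (just a) l

runs : List (Entry q) → ℕ
runs = runsAfter nothing

isNew≤1 : (c : Maybe (Fin q)) (a : Fin q) → isNew c a ≤ 1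
isNew≤1 c a with continues c a
... | true  = z≤n
... | false = s≤s z≤n

runsAfter-≤-suc : (c c′ : Maybe (Fin q)) (l : List (Entry q)) → runsAfter c l ≤ suc (runsAfter c′ l)
runsAfter-≤-suc c c′ []            = z≤n
runsAfter-≤-suc c c′ (nothing ∷ l) = runsAfter-≤-suc c c′ l
runsAfter-≤-suc c c′ (just a ∷ l)  = +-mono-≤ (isNew≤1 c a) (m≤n+m (runsAfter (just a) l) (isNew c′ a))

runsAfter-restart : (c : Maybe (Fin q)) (a : Fin q) (l : List (Entry q)) →
                    runsAfter c l ≤ isNew c a + runsAfter (just a) l
runsAfter-restart nothing  a l = runsAfter-≤-suc nothing (just a) l
runsAfter-restart (just b) a l with b Fin.≟ a
... | yes refl = ≤-refl
... | no _     = runsAfter-≤-suc (just b) (just a) l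

runsAfter-≤-∷ : (c : Maybe (Fin q)) (e : Entry q) (l : List (Entry q)) → runsAfter c l ≤ runsAfter c (e ∷ l)
runsAfter-≤-∷ c nothing  l = ≤-refl
runsAfter-≤-∷ c (just a) l = runsAfter-restart c a l

runsAfter-sublist : (c : Maybe (Fin q)) (l l′ : List (Entry q)) → l′ ∈ₗ sublists l →
                    runsAfter c l′ ≤ runsAfter c l
runsAfter-sublist c []      _  (here refl) = z≤n
runsAfter-sublist c (e ∷ l) l′ l′∈ with ∈-++⁻ (sublists l) l′∈
... | inj₁ l′∈ˡ = ≤-trans (runsAfter-sublist c l l′ l′∈ˡ) (runsAfter-≤-∷ c e l)
... | inj₂ l′∈ʳ with ∈-map⁻ (e ∷_) l′∈ʳ
runsAfter-sublist c (nothing ∷ l) _ _ | inj₂ _ | l″ , l″∈ , refl = runsAfter-sublist c l l″ l″∈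
runsAfter-sublist c (just a ∷ l)  _ _ | inj₂ _ | l″ , l″∈ , refl =
  +-monoʳ-≤ (isNew c a) (runsAfter-sublist (just a) l l″ l″∈)

runsAfter-≤-nonzeros : (c : Maybe (Fin q)) (l : List (Entry q)) → runsAfter c l ≤ length (catMaybes l)
runsAfter-≤-nonzeros c []            = z≤n
runsAfter-≤-nonzeros c (nothing ∷ l) = runsAfter-≤-nonzeros c l
runsAfter-≤-nonzeros c (just a ∷ l)  = +-mono-≤ (isNew≤1 c a) (runsAfter-≤-nonzeros (just a) l)

length-≤-runsAfter : (a : Fin q) (l : List (Entry q)) → alternating (just a ∷ l) ≡ true →
                     length l ≤ runsAfter (just a) l
length-≤-runsAfter a []            _   = z≤n
length-≤-runsAfter a (nothing ∷ l) ()
length-≤-runsAfter a (just b ∷ l)  alt with sameB a b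
... | false = s≤s (length-≤-runsAfter b l alt)

length-≤-runs : (l : List (Entry q)) → alternating l ≡ true → length l ≤ runs l
length-≤-runs []            _   = z≤n
length-≤-runs (nothing ∷ l) ()
length-≤-runs (just a ∷ l)  alt = s≤s (length-≤-runsAfter a l alt)

-- One entry from every block: an alternating subsequence of maximal length.
blockHeads : Maybe (Fin q) → List (Entry q) → List (Entry q)
blockHeads c []            = []
blockHeads c (nothing ∷ l) = blockHeads c l
blockHeads c (just a ∷ l)  = if continues c a then blockHeads (just a) l else just a ∷ blockHeads (just a) l

length-blockHeads : (c : Maybe (Fin q)) (l : List (Entry q)) → length (blockHeads c l) ≡ runsAfter c l
length-blockHeads c []            = refl
length-blockHeads c (nothing ∷ l) = length-blockHeads c l
length-blockHeads c (just a ∷ l) with continues c a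
... | true  = length-blockHeads (just a) l
... | false = cong suc (length-blockHeads (just a) l)

blockHeads-∈-sublists : (c : Maybe (Fin q)) (l : List (Entry q)) → blockHeads c l ∈ₗ sublists l
blockHeads-∈-sublists c []            = here refl
blockHeads-∈-sublists c (nothing ∷ l) = ∈-++⁺ˡ (blockHeads-∈-sublists c l)
blockHeads-∈-sublists c (just a ∷ l) with continues c a
... | true  = ∈-++⁺ˡ (blockHeads-∈-sublists (just a) l)
... | false = ∈-++⁺ʳ (sublists l) (∈-map⁺ (just a ∷_) (blockHeads-∈-sublists (just a) l))

blockHeads-alternatingAfter : (a : Fin q) (l : List (Entry q)) → alternating (just a ∷ blockHeads (just a) l) ≡ true
blockHeads-alternatingAfter a []            = refl
blockHeads-alternatingAfter a (nothing ∷ l) = blockHeads-alternatingAfter a l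
blockHeads-alternatingAfter a (just b ∷ l) with a Fin.≟ b in a≟b
... | yes refl = blockHeads-alternatingAfter b l
... | no _     = subst (λ d → Bool.not ⌊ d ⌋ ∧ alternating (just b ∷ blockHeads (just b) l) ≡ true)
                       (sym a≟b) (blockHeads-alternatingAfter b l)

blockHeads-alternating : (l : List (Entry q)) → alternating (blockHeads nothing l) ≡ true
blockHeads-alternating []            = refl
blockHeads-alternating (nothing ∷ l) = blockHeads-alternating l
blockHeads-alternating (just a ∷ l)  = blockHeads-alternatingAfter a l

longestAlternating : List (Entry q) → ℕ
longestAlternating l = maxList (map length (filter (λ l′ → alternating l′ Bool.≟ true) (sublists l)))

longestAlternating≡runs : (l : List (Entry q)) → longestAlternating l ≡ runs l
longestAlternating≡runs l = ≤-antisym (maxList-≤ _ alternating≤runs) runs≤alternating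
  where
  alternating≤runs : ∀ {m} → m ∈ₗ map length (filter (λ l′ → alternating l′ Bool.≟ true) (sublists l)) →
                     m ≤ runs l
  alternating≤runs m∈ with ∈-map⁻ length m∈
  ... | l′ , l′∈ , refl with ∈-filter⁻ (λ l′ → alternating l′ Bool.≟ true) {xs = sublists l} l′∈
  ... | l′∈sub , alt = ≤-trans (length-≤-runs l′ alt) (runsAfter-sublist nothing l l′ l′∈sub)
  runs≤alternating : runs l ≤ longestAlternating l
  runs≤alternating = subst (_≤ longestAlternating l) (length-blockHeads nothing l)
    (≤-maxList (∈-map⁺ length (∈-filter⁺ (λ l′ → alternating l′ Bool.≟ true)
      (blockHeads-∈-sublists nothing l) (blockHeads-alternating l))))

-- The right-hand side is the local indicator of Defs.supp applied to x i, which cannot be named;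
-- a one-vertex colouring exposes it.
lookup-supp : (x : Fin n → Entry q) (j : Fin q) (i : Fin n) →
              lookup (supp x j) i ≡ lookup (supp {n = 1} (λ _ → x i) j) zero
lookup-supp x j i = lookup∘tabulate _ i

∈-supp⁻ : (x : Fin n → Entry q) (j : Fin q) {i : Fin n} → i ∈ supp x j → x i ≡ just j
∈-supp⁻ x j {i} i∈ with x i | trans (sym (lookup-supp x j i)) ([]=⇒lookup i∈)
... | just k | k≟j = cong just (⌊⌋≡true⁻ (k Fin.≟ j) k≟j)

∈-supp⁺ : (x : Fin n → Entry q) (j : Fin q) {i : Fin n} → x i ≡ just j → i ∈ supp x j
∈-supp⁺ x j {i} xi≡j = lookup⇒[]= i (supp x j) (trans (lookup-supp x j i)
  (subst (λ e → lookup (supp {n = 1} (λ _ → e) j) zero ≡ true) (sym xi≡j) (⌊⌋≡true⁺ (j Fin.≟ j) refl)))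

∈-full : (i : Fin n) → i ∈ full n
∈-full i = lookup⇒[]= i (full _) (lookup∘tabulate _ i)

elems-full : (n : ℕ) → elems (full n) ≡ allFin n
elems-full n = filter-all (_∈? full n) (All.tabulate (λ {i} _ → ∈-full i))

length-elems : (S : Subset n) → length (elems S) ≡ ∣ S ∣
length-elems {n} S = go S id λ _ → refl
  where
  go : ∀ {m} (T : Subset m) (f : Fin m → Fin n) → (∀ i → does (f i ∈? S) ≡ does (i ∈? T)) →
       length (filter (_∈? S) (Data.List.tabulate f)) ≡ ∣ T ∣
  go []      f _ = refl
  go (b ∷ T) f f∈S with does (f zero ∈? S) | f∈S zero
  go (true ∷ T)  f f∈S | true  | refl = cong suc (go T (f ∘ suc) (f∈S ∘ suc))
  go (false ∷ T) f f∈S | false | refl = go T (f ∘ suc) (f∈S ∘ suc)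

edgeFree⁻ : (E : Hypergraph n) {S e : Subset n} → edgeFree E S ≡ true → e ⊆ S → E e ≡ false
edgeFree⁻ E {S} {e} S-free e⊆S with E e in Ee
... | false = refl
... | true with any-≡-true⁺ (λ e → E e ∧ ⌊ e ⊆? S ⌋) (∈-allSubsets e)
                            (∧-≡-true⁺ Ee (⌊⌋≡true⁺ (e ⊆? S) e⊆S))
... | hasEdge rewrite hasEdge = sym S-free

edgeFree⁺ : (E : Hypergraph n) {S : Subset n} → (∀ e → E e ≡ true → ¬ e ⊆ S) → edgeFree E S ≡ true
edgeFree⁺ E {S} noEdge with any (λ e → E e ∧ ⌊ e ⊆? S ⌋) (allSubsets _) in hasEdge
... | false = refl
... | true with any-≡-true⁻ (λ e → E e ∧ ⌊ e ⊆? S ⌋) (allSubsets _) hasEdge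
... | e , _ , Ee∧e⊆S with ∧-≡-true⁻ {E e} Ee∧e⊆S
... | Ee , e⊆S = ⊥-elim (noEdge e Ee (⌊⌋≡true⁻ (e ⊆? S) e⊆S))

edgeFree-anti-mono : (E : Hypergraph n) {S T : Subset n} → S ⊆ T → edgeFree E T ≡ true → edgeFree E S ≡ true
edgeFree-anti-mono E S⊆T T-free =
  edgeFree⁺ E λ e Ee e⊆S → true≢false (trans (sym Ee) (edgeFree⁻ E T-free (S⊆T ∘ e⊆S)))

admissible⁺ : (E : Hypergraph n) (y : Fin n → Entry q) → (∀ j → edgeFree E (supp y j) ≡ true) →
              admissible E y ≡ true
admissible⁺ E y free = all-≡-true⁺ _ (allFin _) λ {j} _ → free j

admissible⁻ : (E : Hypergraph n) (y : Fin n → Entry q) → admissible E y ≡ true →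
              ∀ j → edgeFree E (supp y j) ≡ true
admissible⁻ E y adm j = all-≡-true⁻ _ (allFin _) adm (∈-allFin j)

admissible-≗ : (E : Hypergraph n) {y z : Fin n → Entry q} → y ≗ z →
               admissible E y ≡ true → admissible E z ≡ true
admissible-≗ E {y} {z} y≗z adm = admissible⁺ E z λ j →
  edgeFree-anti-mono E (λ i∈ → ∈-supp⁺ y j (trans (y≗z _) (∈-supp⁻ z j i∈))) (admissible⁻ E y adm j)

admissible⇒∅-non-edge : (E : Hypergraph n) (y : Fin n → Entry (suc q)) → admissible E y ≡ true →
                        edgeFree E ∅ ≡ true
admissible⇒∅-non-edge E y adm = edgeFree-anti-mono E ∅⊆ (admissible⁻ E y adm zero)

admissible-zero : (E : Hypergraph n) (y : Fin n → Entry q) → edgeFree E ∅ ≡ true → (∀ i → y i ≡ nothing) →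
                  admissible E y ≡ true
admissible-zero E y ∅-free y≡0 = admissible⁺ E y λ j →
  edgeFree-anti-mono E (λ {i} i∈ → ⊥-elim (nothing≢just (trans (sym (y≡0 i)) (∈-supp⁻ y j i∈)))) ∅-free

supportedIn-full : (y : Fin n → Entry q) → supportedIn (full n) y ≡ true
supportedIn-full {n} y =
  all-≡-true⁺ _ (allFin n) λ {i} _ → ∨-≡-true⁺ˡ (⌊⌋≡true⁺ (i ∈? full n) (∈-full i))

colourings : (q : ℕ) → Hypergraph n → Subset n → List (Vec (Entry q) n)
colourings {n} q E X = filter (λ v → (supportedIn X (lookup v) ∧ admissible E (lookup v)) Bool.≟ true) (allVecs q n)

∈-colourings⁺ : (q : ℕ) (E : Hypergraph n) (X : Subset n) (v : Vec (Entry q) n) →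
                supportedIn X (lookup v) ≡ true → admissible E (lookup v) ≡ true → v ∈ₗ colourings q E X
∈-colourings⁺ q E X v supported adm =
  ∈-filter⁺ (λ v → (supportedIn X (lookup v) ∧ admissible E (lookup v)) Bool.≟ true)
            (∈-allVecs v) (∧-≡-true⁺ supported adm)

∈-colourings⁻ : (q : ℕ) (E : Hypergraph n) (X : Subset n) {v : Vec (Entry q) n} →
                v ∈ₗ colourings q E X → admissible E (lookup v) ≡ true
∈-colourings⁻ {n} q E X {v} v∈ = proj₂ (∧-≡-true⁻ {supportedIn X (lookup v)}
  (proj₂ (∈-filter⁻ (λ v → (supportedIn X (lookup v) ∧ admissible E (lookup v)) Bool.≟ true)
                    {xs = allVecs q n} v∈)))

altAlong : (q : ℕ) → Hypergraph n → Subset n → List (Fin n) → ℕ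
altAlong q E X π = maxList (map (λ v → altπ π (lookup v)) (colourings q E X))

altInduced-≤-altAlong : (q : ℕ) (E : Hypergraph n) (X : Subset n) {π : List (Fin n)} →
                        π ↭ elems X → altInduced q E X ≤ altAlong q E X π
altInduced-≤-altAlong q E X π↭ = minList-≤ (∈-map⁺ (altAlong q E X) (∈-permutations⁺ _ _ π↭))

alt-attained : (q : ℕ) (E : Hypergraph n) → ∃[ π ] π ↭ allFin n × alt q E ≡ altAlong q E (full n) π
alt-attained {n} q E with ∈-map⁻ (altAlong q E (full n))
  (minList-∈ (∈-map⁺ (altAlong q E (full n)) (∈-permutations⁺ (elems (full n)) _ ↭-refl)))
... | π , π∈ , alt≡ = π , subst (π ↭_) (elems-full n) (∈-permutations⁻ _ π π∈) , alt≡

altπ-≤-altAlong : (q : ℕ) (E : Hypergraph n) (X : Subset n) (π : List (Fin n)) (v : Vec (Entry q) n) →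
                  supportedIn X (lookup v) ≡ true → admissible E (lookup v) ≡ true →
                  altπ π (lookup v) ≤ altAlong q E X π
altπ-≤-altAlong q E X π v supported adm =
  ≤-maxList (∈-map⁺ (λ v → altπ π (lookup v)) (∈-colourings⁺ q E X v supported adm))

altAlong-≤ : (q : ℕ) (E : Hypergraph n) (X : Subset n) (π : List (Fin n)) {b : ℕ} →
             (∀ (v : Vec (Entry q) n) → admissible E (lookup v) ≡ true → altπ π (lookup v) ≤ b) →
             altAlong q E X π ≤ b
altAlong-≤ q E X π bound = maxList-≤ _ λ m∈ → bounded (∈-map⁻ (λ v → altπ π (lookup v)) m∈)
  where
  bounded : ∀ {m} → ∃[ v ] v ∈ₗ colourings q E X × m ≡ altπ π (lookup v) → m ≤ _
  bounded (v , v∈ , refl) = bound v (∈-colourings⁻ q E X v∈)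

-- When ∅ is not an edge, the zero colouring competes in the maximum, so the maximum is attained.
altAlong-attained : (q : ℕ) (E : Hypergraph n) (X : Subset n) (π : List (Fin n)) → edgeFree E ∅ ≡ true →
                    ∃[ y ] admissible E y ≡ true × altAlong q E X π ≤ altπ π y
altAlong-attained {n} q E X π ∅-free
  with maxList-map-attained (λ v → altπ π (lookup v)) (replicate n nothing) (colourings q E X)
... | v , here refl , max≤ =
  lookup v , admissible-zero {q = q} E (lookup (replicate n nothing)) ∅-free (λ i → lookup-replicate i nothing) , max≤
... | v , there v∈ , max≤ = lookup v , ∈-colourings⁻ q E X v∈ , max≤

altAlong-∅-edge : (q : ℕ) (E : Hypergraph n) (X : Subset n) (π : List (Fin n)) → edgeFree E ∅ ≡ false →
                  altAlong (suc q) E X π ≡ 0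
altAlong-∅-edge {n} q E X π ∅-edge =
  cong (maxList ∘ map (λ v → altπ π (lookup v)))
       (filter-none (λ v → (supportedIn X (lookup v) ∧ admissible E (lookup v)) Bool.≟ true) {xs = allVecs (suc q) n}
                    (All.tabulate λ {v} _ candidate →
                      true≢false (trans (sym (admissible⇒∅-non-edge E (lookup v)
                        (proj₂ (∧-≡-true⁻ {supportedIn X (lookup v)} candidate)))) ∅-edge)))

sum-mono-≤ : {f g : Fin n → ℕ} → (∀ i → f i ≤ g i) → sum f ≤ sum g
sum-mono-≤ {zero}  _   = z≤n
sum-mono-≤ {suc n} f≤g = +-mono-≤ (f≤g zero) (sum-mono-≤ (f≤g ∘ suc))

∑-const : (n c : ℕ) → ∑[ i < n ] c ≡ n * c
∑-const zero    c = refl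
∑-const (suc n) c = cong (c +_) (∑-const n c)

sum-updateAt-+ : (f : Fin n → ℕ) (i : Fin n) (a : ℕ) → sum (updateAt f i (a +_)) ≡ a + sum f
sum-updateAt-+ f zero    a = +-assoc a (f zero) _
sum-updateAt-+ f (suc i) a =
  trans (cong (f zero +_) (sum-updateAt-+ (f ∘ suc) i a)) (x∙yz≈y∙xz (f zero) a (sum (f ∘ suc)))

module ColourClasses {r : ℕ} (x : Fin n → Entry r) where

  class : Fin r → List (Fin n) → List (Fin n)
  class j = filter (_∈? supp x j)

  class-∷-≡ : {v : Fin n} {j : Fin r} (ρ : List (Fin n)) → x v ≡ just j → class j (v ∷ ρ) ≡ v ∷ class j ρ
  class-∷-≡ ρ xv≡j = filter-accept (_∈? supp x _) (∈-supp⁺ x _ xv≡j)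

  class-∷-≢ : {v : Fin n} {j : Fin r} (ρ : List (Fin n)) → x v ≢ just j → class j (v ∷ ρ) ≡ class j ρ
  class-∷-≢ ρ xv≢j = filter-reject (_∈? supp x _) (xv≢j ∘ ∈-supp⁻ x _)

  class-∷-other : {v : Fin n} {j j₀ : Fin r} (ρ : List (Fin n)) → x v ≡ just j₀ → j ≢ j₀ →
                  class j (v ∷ ρ) ≡ class j ρ
  class-∷-other ρ xv≡j₀ j≢j₀ = class-∷-≢ ρ λ xv≡j → j≢j₀ (just-injective (trans (sym xv≡j) xv≡j₀))

  length-class-∷ : {v : Fin n} {j₀ : Fin r} (ρ : List (Fin n)) → x v ≡ just j₀ → ∀ j →
                   length (class j (v ∷ ρ)) ≡ updateAt (λ j → length (class j ρ)) j₀ (1 +_) j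
  length-class-∷ {j₀ = j₀} ρ xv≡j₀ j with j Fin.≟ j₀
  ... | yes refl = trans (cong length (class-∷-≡ ρ xv≡j₀)) (sym (updateAt-updates j₀ _))
  ... | no j≢j₀  = trans (cong length (class-∷-other ρ xv≡j₀ j≢j₀)) (sym (updateAt-minimal j j₀ _ j≢j₀))

  ∑-length-class : (ρ : List (Fin n)) → ∑[ j < r ] length (class j ρ) ≡ length (catMaybes (map x ρ))
  ∑-length-class []      = sum-replicate-zero r
  ∑-length-class (v ∷ ρ) with x v in xv
  ... | nothing = trans (sum-cong-≗ λ j → cong length (class-∷-≢ {j = j} ρ (nothing≢just ∘ trans (sym xv))))
                        (∑-length-class ρ)
  ... | just j₀ = trans (sum-cong-≗ (length-class-∷ ρ xv))
                        (trans (sum-updateAt-+ _ j₀ 1) (cong suc (∑-length-class ρ)))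

module ProductColouring {r s : ℕ} (x : Fin n → Entry r) (y : Fin r → Fin n → Entry s) where

  open ColourClasses x

  product : Fin n → Entry (r * s)
  product v = x v >>= λ j → Maybe.map (combine j) (y j v)

  product≡combine⁻ : (v : Fin n) (j : Fin r) (k : Fin s) → product v ≡ just (combine j k) → y j v ≡ just k
  product≡combine⁻ v j k pv with x v
  ... | just j′ with y j′ v in yv
  ...   | just k′ with combine-injective j′ k′ j k (just-injective pv)
  ...     | refl , refl = yv

  product≡nothing⁻ : {v : Fin n} {j : Fin r} → product v ≡ nothing → x v ≡ just j → y j v ≡ nothing
  product≡nothing⁻ {v} {j} pv xv rewrite xv with y j v
  ... | nothing = refl

  product-silentˣ : {v : Fin n} → x v ≡ nothing → product v ≡ nothing
  product-silentˣ xv rewrite xv = refl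

  product-silentʸ : {v : Fin n} {j : Fin r} → x v ≡ just j → y j v ≡ nothing → product v ≡ nothing
  product-silentʸ xv yv rewrite xv | yv = refl

  product-admissible : (E : Hypergraph n) → (∀ j → admissible E (y j) ≡ true) → admissible E product ≡ true
  product-admissible E adm = admissible⁺ E product λ c →
    let j , k , jk≡c = combine-surjective c in
    edgeFree-anti-mono E
      (λ {i} i∈ → ∈-supp⁺ (y j) k
        (product≡combine⁻ i j k (trans (∈-supp⁻ product c i∈) (cong just (sym jk≡c)))))
      (admissible⁻ E (y j) (adm j) k)

  openBlock : (Fin r → Maybe (Fin s)) → Fin r → Fin s → Fin r → Maybe (Fin s)
  openBlock cs j k = updateAt cs j λ _ → just k

  classRuns : (Fin r → Maybe (Fin s)) → List (Fin n) → Fin r → ℕ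
  classRuns cs ρ j = runsAfter (cs j) (map (y j) (class j ρ))

  Consistent : Maybe (Fin (r * s)) → (Fin r → Maybe (Fin s)) → Set
  Consistent c cs = ∀ j k → c ≡ just (combine j k) → cs j ≡ just k

  isNew-consistent : {c : Maybe (Fin (r * s))} {cs : Fin r → Maybe (Fin s)} {j : Fin r} {k : Fin s} →
                     Consistent c cs → isNew (cs j) k ≤ isNew c (combine j k)
  isNew-consistent {c} {cs} {j} {k} consistent with continues c (combine j k) in c-continues
  ... | false = isNew≤1 (cs j) k
  ... | true  rewrite consistent j k (continues≡true⁻ c c-continues) | ⌊⌋≡true⁺ (k Fin.≟ k) refl = ≤-refl

  consistent-openBlock : (cs : Fin r → Maybe (Fin s)) (j₀ : Fin r) (k₀ : Fin s) →
                         Consistent (just (combine j₀ k₀)) (openBlock cs j₀ k₀)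
  consistent-openBlock cs j₀ k₀ j k jk≡ with combine-injective j₀ k₀ j k (just-injective jk≡)
  ... | refl , refl = updateAt-updates j₀ cs

  ∑-classRuns-∷-silent : {v : Fin n} (ρ : List (Fin n)) → product v ≡ nothing → ∀ cs →
                         sum (classRuns cs (v ∷ ρ)) ≡ sum (classRuns cs ρ)
  ∑-classRuns-∷-silent {v} ρ pv cs = sum-cong-≗ unchanged
    where
    unchanged : ∀ j → classRuns cs (v ∷ ρ) j ≡ classRuns cs ρ j
    unchanged j with v ∈? supp x j
    ... | yes v∈ rewrite product≡nothing⁻ pv (∈-supp⁻ x j v∈) = refl
    ... | no _   = refl

  classRuns-∷-block : {v : Fin n} {j₀ : Fin r} {k₀ : Fin s} (ρ : List (Fin n)) →
                      x v ≡ just j₀ → y j₀ v ≡ just k₀ → ∀ cs j →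
                      classRuns cs (v ∷ ρ) j ≡
                      updateAt (classRuns (openBlock cs j₀ k₀) ρ) j₀ (isNew (cs j₀) k₀ +_) j
  classRuns-∷-block {v} {j₀} {k₀} ρ xv yv cs j with j Fin.≟ j₀
  ... | yes refl = begin
    runsAfter (cs j₀) (map (y j₀) (class j₀ (v ∷ ρ)))
      ≡⟨ cong (runsAfter (cs j₀) ∘ map (y j₀)) (class-∷-≡ ρ xv) ⟩
    runsAfter (cs j₀) (y j₀ v ∷ map (y j₀) (class j₀ ρ))
      ≡⟨ cong (λ e → runsAfter (cs j₀) (e ∷ map (y j₀) (class j₀ ρ))) yv ⟩
    isNew (cs j₀) k₀ + runsAfter (just k₀) (map (y j₀) (class j₀ ρ))
      ≡⟨ cong (λ c → isNew (cs j₀) k₀ + runsAfter c (map (y j₀) (class j₀ ρ)))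
              (sym (updateAt-updates j₀ cs)) ⟩
    isNew (cs j₀) k₀ + classRuns (openBlock cs j₀ k₀) ρ j₀
      ≡⟨ sym (updateAt-updates j₀ (classRuns (openBlock cs j₀ k₀) ρ)) ⟩
    updateAt (classRuns (openBlock cs j₀ k₀) ρ) j₀ (isNew (cs j₀) k₀ +_) j₀  ∎
    where open ≡-Reasoning
  ... | no j≢j₀ = begin
    runsAfter (cs j) (map (y j) (class j (v ∷ ρ)))
      ≡⟨ cong (runsAfter (cs j) ∘ map (y j)) (class-∷-other ρ xv j≢j₀) ⟩
    runsAfter (cs j) (map (y j) (class j ρ))
      ≡⟨ cong (λ c → runsAfter c (map (y j) (class j ρ))) (sym (updateAt-minimal j j₀ cs j≢j₀)) ⟩
    classRuns (openBlock cs j₀ k₀) ρ j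
      ≡⟨ sym (updateAt-minimal j j₀ (classRuns (openBlock cs j₀ k₀) ρ) j≢j₀) ⟩
    updateAt (classRuns (openBlock cs j₀ k₀) ρ) j₀ (isNew (cs j₀) k₀ +_) j  ∎
    where open ≡-Reasoning

  ∑-classRuns-≤ : (ρ : List (Fin n)) (c : Maybe (Fin (r * s))) (cs : Fin r → Maybe (Fin s)) → Consistent c cs →
                  sum (classRuns cs ρ) ≤ runsAfter c (map product ρ)
  ∑-classRuns-≤ []      c cs _ = ≤-reflexive (sum-replicate-zero r)
  ∑-classRuns-≤ (v ∷ ρ) c cs consistent with x v in xv
  ... | nothing =
    ≤-trans (≤-reflexive (∑-classRuns-∷-silent ρ (product-silentˣ xv) cs)) (∑-classRuns-≤ ρ c cs consistent)
  ... | just j₀ with y j₀ v in yv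
  ...   | nothing =
    ≤-trans (≤-reflexive (∑-classRuns-∷-silent ρ (product-silentʸ xv yv) cs)) (∑-classRuns-≤ ρ c cs consistent)
  ...   | just k₀ = begin
    sum (classRuns cs (v ∷ ρ))
      ≡⟨ sum-cong-≗ (classRuns-∷-block ρ xv yv cs) ⟩
    sum (updateAt (classRuns (openBlock cs j₀ k₀) ρ) j₀ (isNew (cs j₀) k₀ +_))
      ≡⟨ sum-updateAt-+ (classRuns (openBlock cs j₀ k₀) ρ) j₀ (isNew (cs j₀) k₀) ⟩
    isNew (cs j₀) k₀ + sum (classRuns (openBlock cs j₀ k₀) ρ)
      ≤⟨ +-mono-≤ (isNew-consistent consistent) (∑-classRuns-≤ ρ _ _ (consistent-openBlock cs j₀ k₀)) ⟩
    isNew c (combine j₀ k₀) + runsAfter (just (combine j₀ k₀)) (map product ρ)  ∎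
    where open ≤-Reasoning

<ᵇ≡false⁻ : {m k : ℕ} → (m <ᵇ k) ≡ false → k ≤ m
<ᵇ≡false⁻ m<ᵇk≡false = ≮⇒≥ λ m<k → subst T m<ᵇk≡false (<⇒<ᵇ m<k)

non-edge-T̃ : (H : Hypergraph n) (C s : ℕ) {S : Subset n} → T̃ H C s S ≡ false →
             ∣ S ∣ ≤ (s ∸ 1) * C + altInduced s H S
non-edge-T̃ H C s = <ᵇ≡false⁻

module _ (H : Hypergraph n) (s′ : ℕ) {r : ℕ} (x : Fin n → Entry r) (π : List (Fin n)) where

  open ColourClasses x

  ∑-altAlong-class-≤ : ∑[ j < r ] altAlong (suc s′) H (supp x j) (class j π) ≤
                       altAlong (r * suc s′) H (full n) π
  ∑-altAlong-class-≤ with edgeFree H ∅ in ∅-free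
  ... | false = ≤-trans (≤-reflexive all-zero) z≤n
    where
    all-zero : ∑[ j < r ] altAlong (suc s′) H (supp x j) (class j π) ≡ 0
    all-zero = trans (sum-cong-≗ λ j → altAlong-∅-edge s′ H (supp x j) (class j π) ∅-free) (sum-replicate-zero r)
  ... | true = begin
    ∑[ j < r ] altAlong (suc s′) H (supp x j) (class j π)
      ≤⟨ sum-mono-≤ (λ j → proj₂ (proj₂ (attained j))) ⟩
    ∑[ j < r ] altπ (class j π) (y j)
      ≡⟨ sum-cong-≗ (λ j → longestAlternating≡runs (map (y j) (class j π))) ⟩
    sum (classRuns (λ _ → nothing) π)
      ≤⟨ ∑-classRuns-≤ π nothing (λ _ → nothing) (λ _ _ ()) ⟩
    runs (map product π)
      ≡⟨ cong runs (map-cong (λ v → sym (lookup∘tabulate product v)) π) ⟩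
    runs (map (lookup productVec) π)
      ≡⟨ sym (longestAlternating≡runs (map (lookup productVec) π)) ⟩
    altπ π (lookup productVec)
      ≤⟨ altπ-≤-altAlong (r * suc s′) H (full n) π productVec (supportedIn-full (lookup productVec))
           (admissible-≗ H (λ v → sym (lookup∘tabulate product v))
                           (product-admissible H (proj₁ ∘ proj₂ ∘ attained))) ⟩
    altAlong (r * suc s′) H (full n) π  ∎
    where
    open ≤-Reasoning
    attained : ∀ j → ∃[ y ] admissible H y ≡ true ×
                             altAlong (suc s′) H (supp x j) (class j π) ≤ altπ (class j π) y
    attained j = altAlong-attained (suc s′) H (supp x j) (class j π) ∅-free
    y : Fin r → Fin n → Entry (suc s′)
    y = proj₁ ∘ attained
    open ProductColouring x y
    productVec : Vec (Entry (r * suc s′)) n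
    productVec = tabulate product

  altπ-≤-admissible-T̃ : (C : ℕ) → π ↭ allFin n → admissible (T̃ H C (suc s′)) x ≡ true →
                          altπ π x ≤ r * s′ * C + altAlong (r * suc s′) H (full n) π
  altπ-≤-admissible-T̃ C π↭ adm = begin
    altπ π x                                                          ≡⟨ longestAlternating≡runs (map x π) ⟩
    runs (map x π)                                                    ≤⟨ runsAfter-≤-nonzeros nothing (map x π) ⟩
    length (catMaybes (map x π))                                      ≡⟨ sym (∑-length-class π) ⟩
    ∑[ j < r ] length (class j π)                                     ≤⟨ sum-mono-≤ class-bound ⟩
    ∑[ j < r ] (s′ * C + altAlong (suc s′) H (supp x j) (class j π))
      ≡⟨ ∑-distrib-+ (λ _ → s′ * C) (λ j → altAlong (suc s′) H (supp x j) (class j π)) ⟩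
    ∑[ j < r ] (s′ * C) + ∑[ j < r ] altAlong (suc s′) H (supp x j) (class j π)
      ≤⟨ +-mono-≤ (≤-reflexive (trans (∑-const r (s′ * C)) (sym (*-assoc r s′ C)))) ∑-altAlong-class-≤ ⟩
    r * s′ * C + altAlong (r * suc s′) H (full n) π                   ∎
    where
    open ≤-Reasoning
    class↭ : ∀ j → class j π ↭ elems (supp x j)
    class↭ j = filter-↭ (_∈? supp x j) π↭
    class-bound : ∀ j → length (class j π) ≤ s′ * C + altAlong (suc s′) H (supp x j) (class j π)
    class-bound j = begin
      length (class j π)
        ≡⟨ trans (↭-length (class↭ j)) (length-elems (supp x j)) ⟩
      ∣ supp x j ∣
        ≤⟨ non-edge-T̃ H C (suc s′) (edgeFree⁻ (T̃ H C (suc s′)) (admissible⁻ _ x adm j) id) ⟩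
      s′ * C + altInduced (suc s′) H (supp x j)
        ≤⟨ +-monoʳ-≤ (s′ * C) (altInduced-≤-altAlong (suc s′) H (supp x j) (class↭ j)) ⟩
      s′ * C + altAlong (suc s′) H (supp x j) (class j π)  ∎

lemma7 : (n : ℕ) (H : Hypergraph n) (r s C : ℕ) → NonZero r → NonZero s → NonZero C →
    alt r (T̃ H C s) ≤ r * (s ∸ 1) * C + alt (r * s) H
lemma7 n H r (suc s′) C _ _ _ with alt-attained (r * suc s′) H
... | π , π↭ , alt≡ = begin
  alt r (T̃ H C (suc s′))
    ≤⟨ altInduced-≤-altAlong r (T̃ H C (suc s′)) (full n) (subst (π ↭_) (sym (elems-full n)) π↭) ⟩
  altAlong r (T̃ H C (suc s′)) (full n) π
    ≤⟨ altAlong-≤ r (T̃ H C (suc s′)) (full n) π (λ v → altπ-≤-admissible-T̃ H s′ (lookup v) π C π↭) ⟩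
  r * s′ * C + altAlong (r * suc s′) H (full n) π
    ≡⟨ cong (r * s′ * C +_) (sym alt≡) ⟩
  r * s′ * C + alt (r * suc s′) H  ∎
  where open ≤-Reasoning
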